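{- Let $p,h,k$ be positive integers. There is a bijection between $\mathcal S_{(p,h,k)}=\bigcup_{\alpha\in I_{(h,k)}}\mathcal S_{(p,h,k),\alpha}$ and the set of strongly stable monomial ideals $J\triangleleft\mathbf k[x_1,x_2,x_3]$ with $\mathsf N(J)$ finite whose Bar Code of $\mathsf N(J)$ has bar list $(p,h,k)$.
   Context: $\mathbf k$ is a field of characteristic $0$; terms ordered lexicographically with $x_1<x_2<x_3$. A monomial ideal $J$ is strongly stable if for every term $\tau\in J$ and every pair of variables $x_i<x_j$ with $x_i\mid\tau$, $x_j\tau/x_i\in J$; $\mathsf N(J)$ is the set of terms not in $J$. The bar list of (the Bar Code of) a finite set $M$ of terms is $(\mu(1),\mu(2),\mu(3))$ with $\mu(1)=|M|$, $\mu(2)=|\{x_2^{\gamma_2}x_3^{\gamma_3}: x^\gamma\in M\}|$, $\mu(3)=|\{x_3^{\gamma_3}:x^\gamma\in M\}|$. $I_{(h,k)}$ is the set of $(\alpha_1,\dots,\alpha_k)\in\mathbb N^k$ with $\alpha_1>\dots>\alpha_k>0$, $\sum\alpha_i=h$. For $\alpha\in I_{(h,k)}$, $\mathcal S_{(p,h,k),\alpha}$ is the set of shifted arrays $\pi=(\pi_{i,j})_{1\le i\le k,\ i\le j\le i+\alpha_i-1}$ of integers (shifted $(1,0)$-plane partitions of shape $\lambda=(\lambda_i)$, $\lambda_i=i+\alpha_i-1$) with $\pi_{i,j}>0$; $\pi_{i,j}>\pi_{i,j+1}$ for $i\le j<i+\alpha_i-1$; $\pi_{i,j}\ge\pi_{i+1,j}$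 for $1\le i\le k-1$ and $j$ with both entries defined; and $\sum_{i,j}\pi_{i,j}=p$. -}

module Defs where

open import Data.Nat using (ℕ; zero; suc; _≤_; _<_; _>_; _≟_)
open import Data.Nat.Properties using () renaming (_≟_ to _≟ℕ_)
open import Data.Bool using (Bool; true; false)
open import Data.Product using (_×_; _,_; proj₁; proj₂)
open import Data.Product.Properties using (≡-dec)
open import Data.Unit using (⊤)
open import Data.Empty using (⊥)
open import Data.List using (List; []; _∷_; length; map; deduplicate; drop)
open import Data.Nat.ListAction using (sum)
open import Data.List.Relation.Unary.All using (All)
open import Data.List.Relation.Unary.Linked using (Linked)
open import Data.List.Relation.Unary.Unique.Propositional using (Unique)
open import Data.List.Membership.Propositional using (_∈_)
open import Relation.Binary.PropositionalEquality using (_≡_; refl; sym; trans; setoid)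
open import Relation.Binary.Bundles using (Setoid)
open import Relation.Binary.Definitions using (DecidableEquality)

-- Terms of k[x₁,x₂,x₃]: a term x₁^a x₂^b x₃^c is its exponent triple (a , b , c).

Term : Set
Term = ℕ × ℕ × ℕ

-- A monomial ideal J is identified with its set of terms, given as a
-- (decidable) predicate J : Term → Bool ("τ ∈ J" is "J τ ≡ true").
-- It must be closed under multiplication by every variable.
IsMonomialIdeal : (Term → Bool) → Set
IsMonomialIdeal J = ∀ a b c → J (a , b , c) ≡ true →
  (J (suc a , b , c) ≡ true) × (J (a , suc b , c) ≡ true) × (J (a , b , suc c) ≡ true)

-- Strongly stable w.r.t. x₁ < x₂ < x₃: for τ ∈ J and x_i < x_j with x_i ∣ τ,
-- x_j τ / x_i ∈ J.  The three pairs (i,j) are (1,2), (1,3), (2,3).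
IsStronglyStable : (Term → Bool) → Set
IsStronglyStable J =
    (∀ a b c → J (suc a , b , c) ≡ true → J (a , suc b , c) ≡ true)
  × (∀ a b c → J (suc a , b , c) ≡ true → J (a , b , suc c) ≡ true)
  × (∀ a b c → J (a , suc b , c) ≡ true → J (a , b , suc c) ≡ true)

decℕ² : DecidableEquality (ℕ × ℕ)
decℕ² = ≡-dec _≟ℕ_ _≟ℕ_

μ₁ μ₂ μ₃ : List Term → ℕ
μ₁ M = length M
μ₂ M = length (deduplicate decℕ² (map proj₂ M))
μ₃ M = length (deduplicate _≟ℕ_ (map (λ t → proj₂ (proj₂ t)) M))

barList : List Term → ℕ × ℕ × ℕ
barList M = μ₁ M , μ₂ M , μ₃ M

-- Strongly stable monomial ideals J ◁ k[x₁,x₂,x₃] with N(J) finite and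
-- bar list of N(J) equal to (p , h , k).  N(J) is finite: it is exactly the
-- set of terms of a duplicate-free list N.

record SSIdeal (p h k : ℕ) : Set where
  field
    J        : Term → Bool
    ideal    : IsMonomialIdeal J
    stable   : IsStronglyStable J
    N        : List Term
    N-unique : Unique N
    N-sound  : ∀ t → t ∈ N → J t ≡ false
    N-compl  : ∀ t → J t ≡ false → t ∈ N
    bars     : barList N ≡ (p , h , k)

SSIdealSetoid : ℕ → ℕ → ℕ → Setoid _ _
SSIdealSetoid p h k = record
  { Carrier = SSIdeal p h k
  ; _≈_ = λ I₁ I₂ → ∀ t → SSIdeal.J I₁ t ≡ SSIdeal.J I₂ t
  ; isEquivalence = record
    { refl = λ t → refl
    ; sym = λ e t → sym (e t)
    ; trans = λ e f t → trans (e t) (f t) } }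

record InI (h k : ℕ) (α : List ℕ) : Set where
  field
    len      : length α ≡ k
    decr     : Linked _>_ α
    positive : All (0 <_) α
    total    : sum α ≡ h

-- π is stored as its list of rows; row i (1 ≤ i ≤ k) is the list
-- (π_{i,i}, π_{i,i+1}, …, π_{i,i+αᵢ-1}).
-- Column condition between rows i and i+1: π_{i+1,j} ≤ π_{i,j} for every j
-- where both are defined.  Entry t (0-based) of row i+1 sits in column
-- i+1+t, i.e. under entry t+1 of row i; so we compare row i+1 pointwise
-- with (drop 1 row_i) as long as both are defined.
Below : List ℕ → List ℕ → Set
Below []       _        = ⊤
Below (_ ∷ _)  []       = ⊤
Below (x ∷ xs) (y ∷ ys) = y ≤ x × Below xs ys

ColOK : List ℕ → List ℕ → Set
ColOK upper lower = Below (drop 1 upper) lower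

-- An element of 𝒮_{(p,h,k),α}, paired with its α (so the record type is
-- the disjoint union over α ∈ I_(h,k), i.e. 𝒮_{(p,h,k)}).
record ShiftedPP (p h k : ℕ) : Set where
  field
    α       : List ℕ
    α∈I     : InI h k α
    π       : List (List ℕ)
    shape   : map length π ≡ α
    pos     : All (All (0 <_)) π
    rowDecr : All (Linked _>_) π
    colWeak : Linked ColOK π
    weight  : sum (map sum π) ≡ p

ShiftedPPSetoid : ℕ → ℕ → ℕ → Setoid _ _
ShiftedPPSetoid p h k = record
  { Carrier = ShiftedPP p h k
  ; _≈_ = λ π₁ π₂ → (ShiftedPP.α π₁ ≡ ShiftedPP.α π₂) × (ShiftedPP.π π₁ ≡ ShiftedPP.π π₂)
  ; isEquivalence = record
    { refl = refl , refl
    ; sym = λ { (e , f) → sym e , sym f }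
    ; trans = λ { (e , f) (e' , f') → trans e e' , trans f f' } } }

-- A monomial ideal J ◁ k[x₁,x₂,x₃] with N(J) finite is determined by its heights
-- F(b,c) = min {a : x₁^a x₂^b x₃^c ∈ J}: a term x₁^a x₂^b x₃^c lies in J iff a ≥ F(b,c).
-- J is strongly stable exactly when F(b+1,c) < F(b,c) unless F(b+1,c) = 0 (the move
-- x₁ → x₂, and closure under x₂ where F(b,c) = 0) and F(b,c+1) ≤ F(b+1,c) (the move
-- x₂ → x₃); the move x₁ → x₃ and closure under x₃ then come for free.
-- Writing the non-zero heights F(·,c) as row c+1 of a shifted array, these are exactly
-- the strict-row and weak-column conditions of a shifted (1,0)-plane partition.
-- Since N(J) = {x₁^a x₂^b x₃^c : a < F(b,c)}, its bar list counts the boxes (the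
-- weight p), the cells (h = Σ αᵢ, one x₂^b x₃^c each) and the rows (k, one x₃^c each).
module Submission where

open import Defs

open import Data.Bool using (Bool; true; false)
open import Data.Bool.Properties using (T-≡)
open import Data.Empty using (⊥-elim)
open import Data.List using (List; []; _∷_; length; map; concat; applyUpTo; upTo; deduplicate)
open import Data.List.Properties
  using (length-++; length-map; length-applyUpTo; length-upTo; map-applyUpTo; length-removeAt′)
open import Data.List.Membership.Propositional using (_∈_)
open import Data.List.Membership.Propositional.Properties
  using (∈-map⁺; ∈-map⁻; ∈-applyUpTo⁺; ∈-applyUpTo⁻; ∈-upTo⁺; ∈-upTo⁻; ∈-concat⁺′; ∈-concat⁻′;
         ∈-deduplicate⁺; ∈-deduplicate⁻)
open import Data.List.Relation.Binary.Subset.Propositional using (_⊆_)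
open import Data.List.Relation.Unary.All as All using (All; []; _∷_)
import Data.List.Relation.Unary.All.Properties as All
import Data.List.Relation.Unary.AllPairs.Properties as AllPairs
open import Data.List.Relation.Unary.Any using (here; there; _─_)
open import Data.List.Relation.Unary.Linked using (Linked; []; [-]; _∷_)
import Data.List.Relation.Unary.Linked.Properties as Linked
open import Data.List.Relation.Unary.Unique.Propositional using (Unique; []; _∷_)
import Data.List.Relation.Unary.Unique.Propositional.Properties as Unique
open import Data.List.Relation.Unary.Unique.Propositional.Properties using (upTo⁺)
open import Data.List.Relation.Unary.Unique.DecPropositional.Properties using (deduplicate-!)
open import Data.Nat using (ℕ; zero; suc; _+_; _≤_; _<_; _>_; _≤ᵇ_; z≤n; s≤s)
open import Data.Nat.ListAction using (sum)
open import Data.Nat.Properties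
  using (≤-refl; ≤-reflexive; ≤-antisym; ≤-trans; ≤-<-trans; <-≤-trans; ≮⇒≥; ≤-pred; <⇒≤;
         m≤n⇒m≤1+n; ≰⇒>; <⇒≢; >⇒≢; <⇒≱; m≤m+n; m≤n+m; n≤0⇒n≡0; _≟_; ≤ᵇ⇒≤; ≤⇒≤ᵇ)
open import Data.Product using (Σ; _×_; _,_; proj₁; proj₂)
open import Data.Sum using (_⊎_; inj₁; inj₂; [_,_]′)
open import Data.Unit using (tt)
open import Function using (_∘_; id; case_of_)
open import Function.Bundles using (Equivalence; Bijection)
open import Relation.Binary.Definitions using (DecidableEquality)
open import Relation.Binary.PropositionalEquality
  using (_≡_; _≢_; _≗_; refl; sym; trans; cong; cong₂; subst; module ≡-Reasoning)
open import Relation.Nullary using (contradiction)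

private variable
  A : Set
  d : A
  xs ys zs : List A

lookupOr : A → List A → ℕ → A
lookupOr d []       _       = d
lookupOr d (x ∷ xs) zero    = x
lookupOr d (x ∷ xs) (suc i) = lookupOr d xs i

lookupOr-≥ : ∀ (xs : List A) {i} → length xs ≤ i → lookupOr d xs i ≡ d
lookupOr-≥ []       _           = refl
lookupOr-≥ (x ∷ xs) (s≤s len≤i) = lookupOr-≥ xs len≤i

lookupOr-≢⇒< : ∀ (xs : List A) {i} → lookupOr d xs i ≢ d → i < length xs
lookupOr-≢⇒< xs ≢d = ≰⇒> (≢d ∘ lookupOr-≥ xs)

All-lookupOr : ∀ {P : A → Set} → P d → All P xs → ∀ i → P (lookupOr d xs i)
All-lookupOr Pd []         _       = Pd
All-lookupOr Pd (px ∷ _)   zero    = px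
All-lookupOr Pd (_ ∷ pxs)  (suc i) = All-lookupOr Pd pxs i

All-lookupOr-< : ∀ {P : A → Set} → All P xs → ∀ {i} → i < length xs → P (lookupOr d xs i)
All-lookupOr-< (px ∷ _)  {zero}  _         = px
All-lookupOr-< (_ ∷ pxs) {suc i} (s≤s i<n) = All-lookupOr-< pxs i<n

lookupOr-applyUpTo : ∀ (f : ℕ → A) n → (∀ {i} → n ≤ i → f i ≡ d) →
                     ∀ i → lookupOr d (applyUpTo f n) i ≡ f i
lookupOr-applyUpTo f zero    vanish i       = sym (vanish z≤n)
lookupOr-applyUpTo f (suc n) vanish zero    = refl
lookupOr-applyUpTo f (suc n) vanish (suc i) = lookupOr-applyUpTo (f ∘ suc) n (vanish ∘ s≤s) i

applyUpTo-lookupOr : ∀ (xs : List A) → applyUpTo (lookupOr d xs) (length xs) ≡ xs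
applyUpTo-lookupOr []       = refl
applyUpTo-lookupOr (x ∷ xs) = cong (x ∷_) (applyUpTo-lookupOr xs)

lookupOr-injective : All (_≢ d) xs → All (_≢ d) ys →
                     (∀ i → lookupOr d xs i ≡ lookupOr d ys i) → xs ≡ ys
lookupOr-injective {xs = []}    {ys = []}    _         _         _  = refl
lookupOr-injective {xs = []}    {ys = _ ∷ _} _         (y≢d ∷ _) eq = ⊥-elim (y≢d (sym (eq 0)))
lookupOr-injective {xs = _ ∷ _} {ys = []}    (x≢d ∷ _) _         eq = ⊥-elim (x≢d (eq 0))
lookupOr-injective {xs = _ ∷ _} {ys = _ ∷ _} (_ ∷ pxs) (_ ∷ pys) eq =
  cong₂ _∷_ (eq 0) (lookupOr-injective pxs pys (eq ∘ suc))

length>0⇒≢[] : 0 < length xs → xs ≢ []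
length>0⇒≢[] 0<len xs≡[] = <⇒≢ 0<len (sym (cong length xs≡[]))

≢[]⇒length>0 : xs ≢ [] → 0 < length xs
≢[]⇒length>0 {xs = []}    xs≢[] = contradiction refl xs≢[]
≢[]⇒length>0 {xs = _ ∷ _} _     = s≤s z≤n

applyUpTo-cong : ∀ {f g : ℕ → A} n → (∀ i → f i ≡ g i) → applyUpTo f n ≡ applyUpTo g n
applyUpTo-cong zero    f≗g = refl
applyUpTo-cong (suc n) f≗g = cong₂ _∷_ (f≗g 0) (applyUpTo-cong n (f≗g ∘ suc))

sum-applyUpTo-lookupOr : ∀ (f : A → ℕ) (xs : List A) →
                         sum (applyUpTo (f ∘ lookupOr d xs) (length xs)) ≡ sum (map f xs)
sum-applyUpTo-lookupOr {d = d} f xs =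
  cong sum (trans (sym (map-applyUpTo (lookupOr d xs) f (length xs))) (cong (map f) (applyUpTo-lookupOr xs)))

∈⇒≤sum : ∀ (f : A → ℕ) {x xs} → x ∈ xs → f x ≤ sum (map f xs)
∈⇒≤sum f {xs = x ∷ xs} (here refl) = m≤m+n (f x) _
∈⇒≤sum f {xs = x ∷ xs} (there x∈) = ≤-trans (∈⇒≤sum f x∈) (m≤n+m _ (f x))

∈-remove : ∀ {x y} (x∈ys : x ∈ ys) → y ∈ ys → y ≢ x → y ∈ (ys ─ x∈ys)
∈-remove (here refl)  (here refl) y≢x = ⊥-elim (y≢x refl)
∈-remove (here refl)  (there y∈)  _   = y∈
∈-remove (there x∈)   (here refl) _   = here refl
∈-remove (there x∈)   (there y∈)  y≢x = there (∈-remove x∈ y∈ y≢x)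

Unique-⊆⇒length-≤ : Unique xs → xs ⊆ ys → length xs ≤ length ys
Unique-⊆⇒length-≤ {xs = []}     _            _     = z≤n
Unique-⊆⇒length-≤ {xs = x ∷ xs} {ys} (x∉xs ∷ !xs) xs⊆ys =
  subst (suc (length xs) ≤_) (sym (length-removeAt′ ys _)) (s≤s (Unique-⊆⇒length-≤ !xs xs⊆ys─x))
  where
  x∈ys : x ∈ ys
  x∈ys = xs⊆ys (here refl)

  xs⊆ys─x : xs ⊆ (ys ─ x∈ys)
  xs⊆ys─x y∈xs = ∈-remove x∈ys (xs⊆ys (there y∈xs)) (λ y≡x → All.lookup x∉xs y∈xs (sym y≡x))

Unique-⊆⊇⇒length-≡ : Unique xs → Unique ys → xs ⊆ ys → ys ⊆ xs → length xs ≡ length ys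
Unique-⊆⊇⇒length-≡ !xs !ys xs⊆ys ys⊆xs =
  ≤-antisym (Unique-⊆⇒length-≤ !xs xs⊆ys) (Unique-⊆⇒length-≤ !ys ys⊆xs)

length-deduplicate-≡ : (_≟_ : DecidableEquality A) → Unique zs → xs ⊆ zs → zs ⊆ xs →
                       length (deduplicate _≟_ xs) ≡ length zs
length-deduplicate-≡ _≟_ !zs xs⊆zs zs⊆xs =
  Unique-⊆⊇⇒length-≡ (deduplicate-! _≟_ _) !zs
    (xs⊆zs ∘ ∈-deduplicate⁻ _≟_ _) (∈-deduplicate⁺ _≟_ ∘ zs⊆xs)

∈-concatUpTo⁺ : ∀ (g : ℕ → List A) {n i x} → i < n → x ∈ g i → x ∈ concat (applyUpTo g n)
∈-concatUpTo⁺ g i<n x∈gi = ∈-concat⁺′ x∈gi (∈-applyUpTo⁺ g i<n)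

∈-concatUpTo⁻ : ∀ (g : ℕ → List A) {n x} → x ∈ concat (applyUpTo g n) → Σ ℕ λ i → i < n × x ∈ g i
∈-concatUpTo⁻ g {n} x∈ with ∈-concat⁻′ (applyUpTo g n) x∈
... | _ , x∈xs , xs∈ with ∈-applyUpTo⁻ g xs∈
...   | i , i<n , refl = i , i<n , x∈xs

applyUpTo-unique : ∀ (f : ℕ → A) n → (∀ {i j} → f i ≡ f j → i ≡ j) → Unique (applyUpTo f n)
applyUpTo-unique f n injective = Unique.applyUpTo⁺₁ f n (λ i<j _ → <⇒≢ i<j ∘ injective)

concatUpTo-unique : ∀ (g : ℕ → List A) n → (∀ i → Unique (g i)) →
                    (∀ {i j x} → x ∈ g i → x ∈ g j → i ≡ j) → Unique (concat (applyUpTo g n))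
concatUpTo-unique g n !g separated =
  Unique.concat⁺ (All.applyUpTo⁺₂ g n !g)
    (AllPairs.applyUpTo⁺₁ g n λ i<j _ (x∈gi , x∈gj) → <⇒≢ i<j (separated x∈gi x∈gj))

length-concat : ∀ (xss : List (List A)) → length (concat xss) ≡ sum (map length xss)
length-concat []         = refl
length-concat (xs ∷ xss) = trans (length-++ xs) (cong (length xs +_) (length-concat xss))

length-concatUpTo : ∀ (g : ℕ → List A) n →
                    length (concat (applyUpTo g n)) ≡ sum (applyUpTo (length ∘ g) n)
length-concatUpTo g n = trans (length-concat (applyUpTo g n)) (cong sum (map-applyUpTo g length n))

≤ᵇ-true⁺ : ∀ {m n} → m ≤ n → (m ≤ᵇ n) ≡ true
≤ᵇ-true⁺ m≤n = Equivalence.to T-≡ (≤⇒≤ᵇ m≤n)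

≤ᵇ-true⁻ : ∀ {m n} → (m ≤ᵇ n) ≡ true → m ≤ n
≤ᵇ-true⁻ {m} {n} eq = ≤ᵇ⇒≤ m n (Equivalence.from T-≡ eq)

≤ᵇ-false⁺ : ∀ {m n} → n < m → (m ≤ᵇ n) ≡ false
≤ᵇ-false⁺ {m} {n} n<m with m ≤ᵇ n in eq
... | true  = ⊥-elim (<⇒≱ n<m (≤ᵇ-true⁻ eq))
... | false = refl

≤ᵇ-false⁻ : ∀ {m n} → (m ≤ᵇ n) ≡ false → n < m
≤ᵇ-false⁻ eq = ≰⇒> λ m≤n → case trans (sym (≤ᵇ-true⁺ m≤n)) eq of λ ()

≤ᵇ-injective : ∀ {m n} → (∀ i → (m ≤ᵇ i) ≡ (n ≤ᵇ i)) → m ≡ n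
≤ᵇ-injective {m} {n} eq =
  ≤-antisym (≤ᵇ-true⁻ (trans (eq n) (≤ᵇ-true⁺ (≤-refl {n}))))
            (≤ᵇ-true⁻ (trans (sym (eq m)) (≤ᵇ-true⁺ (≤-refl {m}))))

≤ᵇ-suc : ∀ m n → (m ≤ᵇ n) ≡ (suc m ≤ᵇ suc n)
≤ᵇ-suc zero    n = refl
≤ᵇ-suc (suc m) n = refl

UpClosed : (ℕ → Bool) → Set
UpClosed f = ∀ i → f i ≡ true → f (suc i) ≡ true

upClosed-≤ : ∀ {f} → UpClosed f → ∀ {i j} → i ≤ j → f i ≡ true → f j ≡ true
upClosed-≤         up {j = zero}  z≤n     fi = fi
upClosed-≤         up {j = suc j} z≤n     fi = up j (upClosed-≤ up z≤n fi)
upClosed-≤ {f = f} up             (s≤s i≤j) fi = upClosed-≤ {f = f ∘ suc} (up ∘ suc) i≤j fi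

upClosed⇒threshold : ∀ {f} n → UpClosed f → f n ≡ true → Σ ℕ λ m → f ≗ (m ≤ᵇ_)
upClosed⇒threshold {f} n up fn with f 0 in f0
... | true = 0 , λ i → upClosed-≤ up z≤n f0
upClosed⇒threshold {f} zero    up fn | false = case trans (sym fn) f0 of λ ()
upClosed⇒threshold {f} (suc n) up fn | false
  with m , f∘suc≗ ← upClosed⇒threshold {f ∘ suc} n (up ∘ suc) fn
  = suc m , λ { zero → f0 ; (suc i) → trans (f∘suc≗ i) (≤ᵇ-suc m i) }

record SupportLength (g : ℕ → ℕ) (L : ℕ) : Set where
  field
    positive : ∀ {i} → i < L → 0 < g i
    vanish   : ∀ {i} → L ≤ i → g i ≡ 0

  positive⇒< : ∀ {i} → 0 < g i → i < L
  positive⇒< 0<gi = ≰⇒> λ L≤i → <⇒≢ 0<gi (sym (vanish L≤i))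

vanishing-upClosed : ∀ {g : ℕ → ℕ} → (∀ i → g (suc i) ≤ g i) → UpClosed (λ i → g i ≤ᵇ 0)
vanishing-upClosed antitone i gi≤0 = ≤ᵇ-true⁺ (≤-trans (antitone i) (≤ᵇ-true⁻ gi≤0))

antitone⇒supportLength : ∀ {g : ℕ → ℕ} n → (∀ i → g (suc i) ≤ g i) → g n ≡ 0 →
                         Σ ℕ (SupportLength g)
antitone⇒supportLength n antitone gn≡0
  with L , spec ← upClosed⇒threshold n (vanishing-upClosed antitone) (≤ᵇ-true⁺ (≤-reflexive gn≡0))
  = L , record
    { positive = λ i<L → ≤ᵇ-false⁻ (trans (spec _) (≤ᵇ-false⁺ i<L))
    ; vanish   = λ L≤i → n≤0⇒n≡0 (≤ᵇ-true⁻ (trans (spec _) (≤ᵇ-true⁺ L≤i))) }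

record IsStaircase (F : ℕ → ℕ → ℕ) : Set where
  field
    row-strict     : ∀ b c → F (suc b) c ≡ 0 ⊎ F (suc b) c < F b c
    column-shifted : ∀ b c → F b (suc c) ≤ F (suc b) c

  row-strict-≤ : ∀ a b c → F b c ≤ suc a → F (suc b) c ≤ a
  row-strict-≤ a b c Fbc≤1+a =
    [ (λ eq → ≤-trans (≤-reflexive eq) z≤n) , (λ lt → ≤-pred (≤-trans lt Fbc≤1+a)) ]′ (row-strict b c)

  row-antitone : ∀ b c → F (suc b) c ≤ F b c
  row-antitone b c = [ (λ eq → ≤-trans (≤-reflexive eq) z≤n) , <⇒≤ ]′ (row-strict b c)

  column-antitone : ∀ b c → F b (suc c) ≤ F b c
  column-antitone b c = ≤-trans (column-shifted b c) (row-antitone b c)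

staircaseIdeal : (ℕ → ℕ → ℕ) → Term → Bool
staircaseIdeal F (a , b , c) = F b c ≤ᵇ a

module _ {F : ℕ → ℕ → ℕ} (staircase : IsStaircase F) where
  open IsStaircase staircase

  staircaseIdeal-isMonomialIdeal : IsMonomialIdeal (staircaseIdeal F)
  staircaseIdeal-isMonomialIdeal a b c inJ =
    ≤ᵇ-true⁺ (m≤n⇒m≤1+n Fbc≤a) ,
    ≤ᵇ-true⁺ (≤-trans (row-antitone b c) Fbc≤a) ,
    ≤ᵇ-true⁺ (≤-trans (column-antitone b c) Fbc≤a)
    where
    Fbc≤a : F b c ≤ a
    Fbc≤a = ≤ᵇ-true⁻ inJ

  staircaseIdeal-isStronglyStable : IsStronglyStable (staircaseIdeal F)
  staircaseIdeal-isStronglyStable =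
    (λ a b c inJ → ≤ᵇ-true⁺ (row-strict-≤ a b c (≤ᵇ-true⁻ inJ))) ,
    (λ a b c inJ → ≤ᵇ-true⁺ (≤-trans (column-shifted b c) (row-strict-≤ a b c (≤ᵇ-true⁻ inJ)))) ,
    (λ a b c inJ → ≤ᵇ-true⁺ (≤-trans (column-shifted b c) (≤ᵇ-true⁻ inJ)))

stronglyStable⇒isStaircase : ∀ {J F} → J ≗ staircaseIdeal F →
                             IsMonomialIdeal J → IsStronglyStable J → IsStaircase F
stronglyStable⇒isStaircase {J} {F} J≗ ideal (x₁→x₂ , _ , x₂→x₃) = record
  { row-strict     = row-strict
  ; column-shifted = λ b c → inJ⁻ (x₂→x₃ _ b c (inJ⁺ ≤-refl)) }
  where
  inJ⁺ : ∀ {a b c} → F b c ≤ a → J (a , b , c) ≡ true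
  inJ⁺ Fbc≤a = trans (J≗ _) (≤ᵇ-true⁺ Fbc≤a)

  inJ⁻ : ∀ {a b c} → J (a , b , c) ≡ true → F b c ≤ a
  inJ⁻ inJ = ≤ᵇ-true⁻ (trans (sym (J≗ _)) inJ)

  row-strict : ∀ b c → F (suc b) c ≡ 0 ⊎ F (suc b) c < F b c
  row-strict b c with F b c in Fbc
  ... | zero  = inj₁ (n≤0⇒n≡0 (inJ⁻ (proj₁ (proj₂ (ideal 0 b c (inJ⁺ (≤-reflexive Fbc)))))))
  ... | suc m = inj₂ (s≤s (inJ⁻ (x₁→x₂ m b c (inJ⁺ (≤-reflexive Fbc)))))

monomialIdeal⇒staircaseIdeal : ∀ {J} B → IsMonomialIdeal J → (∀ b c → J (B , b , c) ≡ true) →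
                               Σ (ℕ → ℕ → ℕ) λ F → J ≗ staircaseIdeal F
monomialIdeal⇒staircaseIdeal {J} B ideal bounded =
  (λ b c → proj₁ (height b c)) , λ { (a , b , c) → proj₂ (height b c) a }
  where
  height : ∀ b c → Σ ℕ λ m → (λ a → J (a , b , c)) ≗ (m ≤ᵇ_)
  height b c = upClosed⇒threshold B (λ a → proj₁ ∘ ideal a b c) (bounded b c)

-- π stores its rows from the top; entry π b c is π_{c+1,c+1+b} (zero outside the shape).
entry : List (List ℕ) → ℕ → ℕ → ℕ
entry π b c = lookupOr 0 (lookupOr [] π c) b

rowLength : List (List ℕ) → ℕ → ℕ
rowLength π c = length (lookupOr [] π c)

lookupOr-strict : ∀ {r} → Linked _>_ r →
                  ∀ b → lookupOr 0 r (suc b) ≡ 0 ⊎ lookupOr 0 r (suc b) < lookupOr 0 r b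
lookupOr-strict []         b       = inj₁ refl
lookupOr-strict [-]        b       = inj₁ refl
lookupOr-strict (x>y ∷ _)  zero    = inj₂ x>y
lookupOr-strict (_ ∷ r>)   (suc b) = lookupOr-strict r> b

Below⇒lookupOr-≤ : ∀ {u l} → Below u l → length l ≤ length u → ∀ b → lookupOr 0 l b ≤ lookupOr 0 u b
Below⇒lookupOr-≤ {l = []}                _           _          _       = z≤n
Below⇒lookupOr-≤ {u = _ ∷ _} {l = _ ∷ _} (y≤x , _)   _          zero    = y≤x
Below⇒lookupOr-≤ {u = _ ∷ _} {l = _ ∷ _} (_ , below) (s≤s len≤) (suc b) = Below⇒lookupOr-≤ below len≤ b

Below-applyUpTo : ∀ {f g : ℕ → ℕ} n m → (∀ i → g i ≤ f i) → Below (applyUpTo f n) (applyUpTo g m)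
Below-applyUpTo zero    m       g≤f = tt
Below-applyUpTo (suc n) zero    g≤f = tt
Below-applyUpTo (suc n) (suc m) g≤f = g≤f 0 , Below-applyUpTo n m (g≤f ∘ suc)

entry-column-shifted : ∀ π → Linked ColOK π → Linked _>_ (map length π) →
                       ∀ b c → entry π b (suc c) ≤ entry π (suc b) c
entry-column-shifted []                _           _                b _       = z≤n
entry-column-shifted (_ ∷ [])          _           _                b _       = z≤n
entry-column-shifted ((_ ∷ _) ∷ _ ∷ _) (col ∷ _)   (s≤s len< ∷ _)   b zero    = Below⇒lookupOr-≤ col len< b
entry-column-shifted (_ ∷ π)           (_ ∷ cols)  (_ ∷ lens)       b (suc c) = entry-column-shifted π cols lens b c

entry-isStaircase : ∀ {π} → All (Linked _>_) π → Linked ColOK π → Linked _>_ (map length π) →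
                    IsStaircase (entry π)
entry-isStaircase {π} rows> cols lens> = record
  { row-strict     = λ b c → lookupOr-strict (All-lookupOr [] rows> c) b
  ; column-shifted = entry-column-shifted π cols lens> }

lengths-positive⇒nonempty : ∀ {π : List (List ℕ)} → All (0 <_) (map length π) → All (_≢ []) π
lengths-positive⇒nonempty lengths>0 = All.map length>0⇒≢[] (All.map⁻ lengths>0)

entry-injective : ∀ {π π′} → All (All (0 <_)) π → All (All (0 <_)) π′ →
                  All (_≢ []) π → All (_≢ []) π′ →
                  (∀ b c → entry π b c ≡ entry π′ b c) → π ≡ π′
entry-injective entries>0 entries′>0 rows≢[] rows′≢[] eq =
  lookupOr-injective rows≢[] rows′≢[] λ c →
    lookupOr-injective (nonzero entries>0 c) (nonzero entries′>0 c) λ b → eq b c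
  where
  nonzero : ∀ {π} → All (All (0 <_)) π → ∀ c → All (_≢ 0) (lookupOr [] π c)
  nonzero entries>0 = All-lookupOr [] (All.map (All.map >⇒≢) entries>0)

<entry⇒<rowLength : ∀ π {a b c} → a < entry π b c → b < rowLength π c
<entry⇒<rowLength π {c = c} a<e = lookupOr-≢⇒< (lookupOr [] π c) (>⇒≢ (≤-<-trans z≤n a<e))

<rowLength⇒<length : ∀ π {b c} → b < rowLength π c → c < length π
<rowLength⇒<length π b<len = lookupOr-≢⇒< π (length>0⇒≢[] (≤-<-trans z≤n b<len))

cellTerms : List (List ℕ) → ℕ → ℕ → List Term
cellTerms π b c = applyUpTo (λ a → (a , b , c)) (entry π b c)

rowTerms : List (List ℕ) → ℕ → List Term
rowTerms π c = concat (applyUpTo (λ b → cellTerms π b c) (rowLength π c))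

staircaseTerms : List (List ℕ) → List Term
staircaseTerms π = concat (applyUpTo (rowTerms π) (length π))

∈-rowTerms⁻ : ∀ π {c t} → t ∈ rowTerms π c → Σ ℕ λ a → Σ ℕ λ b → a < entry π b c × t ≡ (a , b , c)
∈-rowTerms⁻ π {c} t∈ with b , _ , t∈cell ← ∈-concatUpTo⁻ (λ b → cellTerms π b c) {rowLength π c} t∈
                     with a , a<e , refl ← ∈-applyUpTo⁻ _ {n = entry π b c} t∈cell
  = a , b , a<e , refl

∈-staircaseTerms⁻ : ∀ π {a b c} → (a , b , c) ∈ staircaseTerms π → a < entry π b c
∈-staircaseTerms⁻ π t∈ with c , _ , t∈row ← ∈-concatUpTo⁻ (rowTerms π) {length π} t∈
                       with _ , _ , a<e , refl ← ∈-rowTerms⁻ π t∈row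
  = a<e

∈-staircaseTerms⁺ : ∀ π {a b c} → a < entry π b c → (a , b , c) ∈ staircaseTerms π
∈-staircaseTerms⁺ π {a} {b} {c} a<e =
  ∈-concatUpTo⁺ (rowTerms π) (<rowLength⇒<length π b<len)
    (∈-concatUpTo⁺ (λ b → cellTerms π b c) b<len (∈-applyUpTo⁺ _ a<e))
  where
  b<len : b < rowLength π c
  b<len = <entry⇒<rowLength π a<e

staircaseTerms-unique : ∀ π → Unique (staircaseTerms π)
staircaseTerms-unique π =
  concatUpTo-unique (rowTerms π) (length π) row-unique
    λ t∈ t∈′ → third (∈-rowTerms⁻ π t∈) (∈-rowTerms⁻ π t∈′)
  where
  third : ∀ {t c c′} → (Σ ℕ λ a → Σ ℕ λ b → a < entry π b c × t ≡ (a , b , c)) →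
                        (Σ ℕ λ a → Σ ℕ λ b → a < entry π b c′ × t ≡ (a , b , c′)) → c ≡ c′
  third (_ , _ , _ , refl) (_ , _ , _ , refl) = refl

  cell-unique : ∀ b c → Unique (cellTerms π b c)
  cell-unique b c = applyUpTo-unique _ (entry π b c) (cong proj₁)

  row-unique : ∀ c → Unique (rowTerms π c)
  row-unique c = concatUpTo-unique _ (rowLength π c) (λ b → cell-unique b c) second
    where
    second : ∀ {b b′ t} → t ∈ cellTerms π b c → t ∈ cellTerms π b′ c → b ≡ b′
    second {b} {b′} t∈ t∈′
      with _ , _ , refl ← ∈-applyUpTo⁻ _ {n = entry π b c} t∈
      with _ , _ , refl ← ∈-applyUpTo⁻ _ {n = entry π b′ c} t∈′ = refl

length-staircaseTerms : ∀ π → length (staircaseTerms π) ≡ sum (map sum π)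
length-staircaseTerms π = begin
  length (staircaseTerms π)                        ≡⟨ length-concatUpTo (rowTerms π) (length π) ⟩
  sum (applyUpTo (length ∘ rowTerms π) (length π)) ≡⟨ cong sum (applyUpTo-cong (length π) length-row) ⟩
  sum (applyUpTo (sum ∘ lookupOr [] π) (length π)) ≡⟨ sum-applyUpTo-lookupOr sum π ⟩
  sum (map sum π)                                  ∎
  where
  open ≡-Reasoning
  length-row : ∀ c → length (rowTerms π c) ≡ sum (lookupOr [] π c)
  length-row c = begin
    length (rowTerms π c)
      ≡⟨ length-concatUpTo _ (rowLength π c) ⟩
    sum (applyUpTo (λ b → length (cellTerms π b c)) (rowLength π c))
      ≡⟨ cong sum (applyUpTo-cong (rowLength π c) λ b → length-applyUpTo _ (entry π b c)) ⟩
    sum (applyUpTo (λ b → entry π b c) (rowLength π c))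
      ≡⟨ cong sum (applyUpTo-lookupOr (lookupOr [] π c)) ⟩
    sum (lookupOr [] π c)
      ∎

staircaseCells : List (List ℕ) → List (ℕ × ℕ)
staircaseCells π = concat (applyUpTo (λ c → applyUpTo (λ b → (b , c)) (rowLength π c)) (length π))

∈-staircaseCells⁻ : ∀ π {b c} → (b , c) ∈ staircaseCells π → b < rowLength π c
∈-staircaseCells⁻ π bc∈ with c , _ , bc∈row ← ∈-concatUpTo⁻ _ {length π} bc∈
                        with _ , b<len , refl ← ∈-applyUpTo⁻ _ {n = rowLength π c} bc∈row
  = b<len

∈-staircaseCells⁺ : ∀ π {b c} → b < rowLength π c → (b , c) ∈ staircaseCells π
∈-staircaseCells⁺ π b<len =
  ∈-concatUpTo⁺ _ (<rowLength⇒<length π b<len) (∈-applyUpTo⁺ _ b<len)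

staircaseCells-unique : ∀ π → Unique (staircaseCells π)
staircaseCells-unique π =
  concatUpTo-unique _ (length π) (λ c → applyUpTo-unique _ (rowLength π c) (cong proj₁)) second
  where
  second : ∀ {c c′ x} → x ∈ applyUpTo (λ b → (b , c)) (rowLength π c) →
                        x ∈ applyUpTo (λ b → (b , c′)) (rowLength π c′) → c ≡ c′
  second {c} {c′} x∈ x∈′
    with _ , _ , refl ← ∈-applyUpTo⁻ _ {n = rowLength π c} x∈
    with _ , _ , refl ← ∈-applyUpTo⁻ _ {n = rowLength π c′} x∈′ = refl

length-staircaseCells : ∀ π → length (staircaseCells π) ≡ sum (map length π)
length-staircaseCells π = begin
  length (staircaseCells π)
    ≡⟨ length-concatUpTo _ (length π) ⟩
  sum (applyUpTo (λ c → length (applyUpTo (λ b → (b , c)) (rowLength π c))) (length π))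
    ≡⟨ cong sum (applyUpTo-cong (length π) λ c → length-applyUpTo _ (rowLength π c)) ⟩
  sum (applyUpTo (rowLength π) (length π))
    ≡⟨ sum-applyUpTo-lookupOr length π ⟩
  sum (map length π)
    ∎
  where open ≡-Reasoning

module _ (π : List (List ℕ)) (entries>0 : All (All (0 <_)) π) (rows≢[] : All (_≢ []) π) where

  entry-positive : ∀ {b c} → b < rowLength π c → 0 < entry π b c
  entry-positive {c = c} = All-lookupOr-< (All-lookupOr [] entries>0 c)

  rowLength-positive : ∀ {c} → c < length π → 0 < rowLength π c
  rowLength-positive c<len = ≢[]⇒length>0 (All-lookupOr-< rows≢[] c<len)

  barList-staircaseTerms : ∀ {M} → Unique M → M ⊆ staircaseTerms π → staircaseTerms π ⊆ M →
                           barList M ≡ (sum (map sum π) , sum (map length π) , length π)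
  barList-staircaseTerms {M} !M M⊆ ⊆M = cong₂ _,_ μ₁≡ (cong₂ _,_ μ₂≡ μ₃≡)
    where
    μ₁≡ : μ₁ M ≡ sum (map sum π)
    μ₁≡ = trans (Unique-⊆⊇⇒length-≡ !M (staircaseTerms-unique π) M⊆ ⊆M) (length-staircaseTerms π)

    μ₂≡ : μ₂ M ≡ sum (map length π)
    μ₂≡ = trans (length-deduplicate-≡ decℕ² (staircaseCells-unique π) cells⁺ cells⁻) (length-staircaseCells π)
      where
      cells⁺ : map proj₂ M ⊆ staircaseCells π
      cells⁺ bc∈ with (a , b , c) , t∈M , refl ← ∈-map⁻ proj₂ bc∈ =
        ∈-staircaseCells⁺ π (<entry⇒<rowLength π (∈-staircaseTerms⁻ π (M⊆ t∈M)))
      cells⁻ : staircaseCells π ⊆ map proj₂ M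
      cells⁻ {b , c} bc∈ =
        ∈-map⁺ proj₂ (⊆M (∈-staircaseTerms⁺ π {0} (entry-positive (∈-staircaseCells⁻ π bc∈))))

    μ₃≡ : μ₃ M ≡ length π
    μ₃≡ = trans (length-deduplicate-≡ _≟_ (upTo⁺ (length π)) rows⁺ rows⁻) (length-upTo (length π))
      where
      rows⁺ : map (λ t → proj₂ (proj₂ t)) M ⊆ upTo (length π)
      rows⁺ c∈ with (a , b , c) , t∈M , refl ← ∈-map⁻ (λ t → proj₂ (proj₂ t)) c∈ =
        ∈-upTo⁺ (<rowLength⇒<length π (<entry⇒<rowLength π (∈-staircaseTerms⁻ π (M⊆ t∈M))))
      rows⁻ : upTo (length π) ⊆ map (λ t → proj₂ (proj₂ t)) M
      rows⁻ c∈ = ∈-map⁺ (λ t → proj₂ (proj₂ t))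
        (⊆M (∈-staircaseTerms⁺ π {0} {0} (entry-positive (rowLength-positive (∈-upTo⁻ c∈)))))

module StaircasePartition {F : ℕ → ℕ → ℕ} (staircase : IsStaircase F)
  (B : ℕ) (row-vanish : ∀ c → F B c ≡ 0) (corner-vanish : F 0 B ≡ 0) where

  open IsStaircase staircase

  rowSupport : ∀ c → Σ ℕ (SupportLength (λ b → F b c))
  rowSupport c = antitone⇒supportLength B (λ b → row-antitone b c) (row-vanish c)

  columnSupport : Σ ℕ (SupportLength (F 0))
  columnSupport = antitone⇒supportLength B (column-antitone 0) corner-vanish

  len : ℕ → ℕ
  len c = proj₁ (rowSupport c)

  K : ℕ
  K = proj₁ columnSupport

  module Row c = SupportLength (proj₂ (rowSupport c))
  module Col = SupportLength (proj₂ columnSupport)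

  row : ℕ → List ℕ
  row c = applyUpTo (λ b → F b c) (len c)

  partition : List (List ℕ)
  partition = applyUpTo row K

  row-[] : ∀ {c} → K ≤ c → row c ≡ []
  row-[] {c} K≤c =
    cong (applyUpTo _) (n≤0⇒n≡0 (≮⇒≥ λ 0<len → <⇒≢ (Row.positive c 0<len) (sym (Col.vanish K≤c))))

  entry-partition : ∀ b c → entry partition b c ≡ F b c
  entry-partition b c = begin
    lookupOr 0 (lookupOr [] partition c) b ≡⟨ cong (λ r → lookupOr 0 r b) (lookupOr-applyUpTo row K row-[] c) ⟩
    lookupOr 0 (row c) b                   ≡⟨ lookupOr-applyUpTo _ (len c) (Row.vanish c) b ⟩
    F b c                                  ∎
    where open ≡-Reasoning

  shape : map length partition ≡ applyUpTo len K
  shape = trans (map-applyUpTo row length K) (applyUpTo-cong K λ c → length-applyUpTo _ (len c))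

  entries-positive : All (All (0 <_)) partition
  entries-positive = All.applyUpTo⁺₂ row K λ c → All.applyUpTo⁺₁ _ (len c) (Row.positive c)

  rows-decreasing : All (Linked _>_) partition
  rows-decreasing = All.applyUpTo⁺₂ row K λ c → Linked.applyUpTo⁺₁ _ (len c) λ {b} 1+b<len →
    [ (λ F≡0 → contradiction F≡0 (>⇒≢ (Row.positive c 1+b<len))) , id ]′ (row-strict b c)

  columns-weak : Linked ColOK partition
  columns-weak = Linked.applyUpTo⁺₂ row K columns
    where
    columns : ∀ c → ColOK (row c) (row (suc c))
    columns c with len c
    ... | zero  = tt
    ... | suc n = Below-applyUpTo n (len (suc c)) (λ b → column-shifted b c)

  lengths-positive : All (0 <_) (applyUpTo len K)
  lengths-positive = All.applyUpTo⁺₁ len K λ c<K → Row.positive⇒< _ (Col.positive c<K)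

  lengths-decreasing : Linked _>_ (applyUpTo len K)
  lengths-decreasing = Linked.applyUpTo⁺₁ len K λ {c} 1+c<K →
    last-shift (Row.positive⇒< (suc c) (Col.positive 1+c<K)) λ b<len →
      Row.positive⇒< c (<-≤-trans (Row.positive (suc c) b<len) (column-shifted _ c))
    where
    last-shift : ∀ {m n} → 0 < m → (∀ {b} → b < m → suc b < n) → m < n
    last-shift {suc m} _ shift = shift ≤-refl

termSize : Term → ℕ
termSize (a , b , c) = a + b + c

module _ {p h k : ℕ} where

  module FromShiftedPP (x : ShiftedPP p h k) where
    open ShiftedPP x
    open InI α∈I

    rows≢[] : All (_≢ []) π
    rows≢[] = lengths-positive⇒nonempty (subst (All (0 <_)) (sym shape) positive)

    staircase : IsStaircase (entry π)
    staircase = entry-isStaircase rowDecr colWeak (subst (Linked _>_) (sym shape) decr)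

    statistics : (sum (map sum π) , sum (map length π) , length π) ≡ (p , h , k)
    statistics = cong₂ _,_ weight (cong₂ _,_ (trans (cong sum shape) total)
                                             (trans (sym (length-map length π)) (trans (cong length shape) len)))

    ideal : SSIdeal p h k
    ideal = record
      { J        = staircaseIdeal (entry π)
      ; ideal    = staircaseIdeal-isMonomialIdeal staircase
      ; stable   = staircaseIdeal-isStronglyStable staircase
      ; N        = staircaseTerms π
      ; N-unique = staircaseTerms-unique π
      ; N-sound  = λ { (a , b , c) t∈ → ≤ᵇ-false⁺ (∈-staircaseTerms⁻ π t∈) }
      ; N-compl  = λ { (a , b , c) t∉J → ∈-staircaseTerms⁺ π (≤ᵇ-false⁻ t∉J) }
      ; bars     = trans (barList-staircaseTerms π pos rows≢[] (staircaseTerms-unique π) id id) statistics }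

  toIdeal : ShiftedPP p h k → SSIdeal p h k
  toIdeal = FromShiftedPP.ideal

  toIdeal-injective : ∀ {x x′} → (∀ t → SSIdeal.J (toIdeal x) t ≡ SSIdeal.J (toIdeal x′) t) →
                      (ShiftedPP.α x ≡ ShiftedPP.α x′) × (ShiftedPP.π x ≡ ShiftedPP.π x′)
  toIdeal-injective {x} {x′} sameJ =
    trans (sym (ShiftedPP.shape x)) (trans (cong (map length) π≡π′) (ShiftedPP.shape x′)) , π≡π′
    where
    π≡π′ : ShiftedPP.π x ≡ ShiftedPP.π x′
    π≡π′ = entry-injective (ShiftedPP.pos x) (ShiftedPP.pos x′)
             (FromShiftedPP.rows≢[] x) (FromShiftedPP.rows≢[] x′)
             (λ b c → ≤ᵇ-injective λ a → sameJ (a , b , c))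

  module FromIdeal (y : SSIdeal p h k) where
    open SSIdeal y

    B : ℕ
    B = suc (sum (map termSize N))

    large⇒∈J : ∀ {t} → B ≤ termSize t → J t ≡ true
    large⇒∈J {t} large with J t in t∉J
    ... | true  = refl
    ... | false = contradiction (∈⇒≤sum termSize (N-compl t t∉J)) (<⇒≱ large)

    heights : Σ (ℕ → ℕ → ℕ) λ F → J ≗ staircaseIdeal F
    heights = monomialIdeal⇒staircaseIdeal B ideal λ b c → large⇒∈J (≤-trans (m≤m+n B b) (m≤m+n (B + b) c))

    F : ℕ → ℕ → ℕ
    F = proj₁ heights

    J≗ : J ≗ staircaseIdeal F
    J≗ = proj₂ heights

    vanish : ∀ b c → B ≤ b + c → F b c ≡ 0
    vanish b c large = n≤0⇒n≡0 (≤ᵇ-true⁻ (trans (sym (J≗ (0 , b , c))) (large⇒∈J large)))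

    open StaircasePartition {F} (stronglyStable⇒isStaircase {F = F} J≗ ideal stable) B
      (λ c → vanish B c (m≤m+n B c)) (vanish 0 B ≤-refl)

    N⊆ : N ⊆ staircaseTerms partition
    N⊆ {a , b , c} t∈N = ∈-staircaseTerms⁺ partition (subst (a <_) (sym (entry-partition b c))
      (≤ᵇ-false⁻ (trans (sym (J≗ _)) (N-sound _ t∈N))))

    ⊆N : staircaseTerms partition ⊆ N
    ⊆N {a , b , c} t∈ = N-compl _ (trans (J≗ _) (≤ᵇ-false⁺ (subst (a <_) (entry-partition b c)
      (∈-staircaseTerms⁻ partition t∈))))

    statistics : (sum (map sum partition) , sum (map length partition) , length partition) ≡ (p , h , k)
    statistics = trans (sym (barList-staircaseTerms partition entries-positive
                         (lengths-positive⇒nonempty (subst (All (0 <_)) (sym shape) lengths-positive))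
                         N-unique N⊆ ⊆N)) bars

    shiftedPP : ShiftedPP p h k
    shiftedPP = record
      { α       = map length partition
      ; α∈I     = record
        { len      = trans (length-map length partition) (cong (proj₂ ∘ proj₂) statistics)
        ; decr     = subst (Linked _>_) (sym shape) lengths-decreasing
        ; positive = subst (All (0 <_)) (sym shape) lengths-positive
        ; total    = cong (proj₁ ∘ proj₂) statistics }
      ; π       = partition
      ; shape   = refl
      ; pos     = entries-positive
      ; rowDecr = rows-decreasing
      ; colWeak = columns-weak
      ; weight  = cong proj₁ statistics }

    toIdeal-shiftedPP : ∀ t → SSIdeal.J (toIdeal shiftedPP) t ≡ J t
    toIdeal-shiftedPP (a , b , c) = trans (cong (_≤ᵇ a) (entry-partition b c)) (sym (J≗ _))

mainTheorem15 : (p h k : ℕ) → 0 < p → 0 < h → 0 < k →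
    Bijection (ShiftedPPSetoid p h k) (SSIdealSetoid p h k)
mainTheorem15 p h k _ _ _ = record
  { to        = toIdeal
  ; cong      = λ (_ , π≡π′) t → cong (λ π → staircaseIdeal (entry π) t) π≡π′
  ; bijective = (λ {x} {x′} → toIdeal-injective {x = x} {x′})
              , λ y → FromIdeal.shiftedPP y , λ (_ , π≡π′) t →
                  trans (cong (λ π → staircaseIdeal (entry π) t) π≡π′) (FromIdeal.toIdeal-shiftedPP y t) }
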